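{- Let $p$ be a prime and let $x,y,z$ be positive integers with $x \le y \le z$ and $$\frac{4}{p} = \frac{1}{x} + \frac{1}{y} + \frac{1}{z}.$$ If $y = \left\lfloor \frac{px}{4x-p} \right\rfloor + 1$, then $x = \left\lfloor \frac{py}{4y-p} \right\rfloor + 1$.
   Context: In this paper a solution of $\frac{4}{p} = \frac{1}{x}+\frac{1}{y}+\frac{1}{z}$ for a prime $p$ means a triple of positive integers $(x,y,z)$ satisfying the equation, with the standing normalization $x \le y \le z$. Such a solution is called of type I(a) if $y = \lfloor px/(4x-p)\rfloor + 1$, and of type I(b) if $x = \lfloor py/(4y-p)\rfloor + 1$; the proposition says every type I(a) solution is a type I(b) solution. -}

module Defs where

open import Data.Nat using (ℕ; zero; suc; _+_; _*_; _∸_)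
open import Data.Nat.DivMod using (_/_)
open import Relation.Binary.PropositionalEquality using (_≡_)

-- Floor division ⌊ m / n ⌋ on ℕ; the value for n = 0 is an irrelevant
-- convention (set to 0). In the statement the denominator 4x − p is
-- always positive, since 4/p = 1/x + 1/y + 1/z > 1/x forces 4x > p.
floorDiv : ℕ → ℕ → ℕ
floorDiv m zero    = 0
floorDiv m (suc n) = m / suc n

EgyptianEq : ℕ → ℕ → ℕ → ℕ → Set
EgyptianEq p x y z = 4 * x * y * z ≡ p * (y * z + x * z + x * y)

{-# OPTIONS --safe #-}
-- Write s = 4x − p > 0 and y = x + t. Then 4y − p = s + 4t, and 4x = p + s gives the identity
-- x(s + 4t) = sy + pt. The hypothesis y = ⌊px/s⌋ + 1 says s(y − 1) ≤ px < sy; adding pt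
-- turns this into x(s + 4t) − (s + 4t) ≤ py < x(s + 4t), i.e. ⌊py/(4y − p)⌋ = x − 1.
module Submission where

open import Defs
open import Data.Nat using (ℕ; zero; suc; _+_; _*_; _∸_; _≤_; _<_; NonZero; s≤s; z≤n)
open import Data.Nat.Properties
open import Data.Nat.DivMod using (_/_; _%_; m≡m%n+[m/n]*n; m%n<n; m/n*n≤m; m<n*o⇒m/o<n; m*n/n≡m; /-monoˡ-≤)
open import Data.Nat.Primality using (Prime)
open import Data.Nat.Tactic.RingSolver using (solve-∀)
open import Relation.Binary.PropositionalEquality

/-unique : ∀ n d k .{{_ : NonZero d}} → k * d ≤ n → n < suc k * d → n / d ≡ k
/-unique n d k lower upper = ≤-antisym
  (≤-pred (m<n*o⇒m/o<n upper))
  (≤-trans (≤-reflexive (sym (m*n/n≡m k d))) (/-monoˡ-≤ d lower))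

m<[1+m/n]*n : ∀ m n .{{_ : NonZero n}} → m < suc (m / n) * n
m<[1+m/n]*n m n = begin-strict
  m                   ≡⟨ m≡m%n+[m/n]*n m n ⟩
  m % n + m / n * n   <⟨ +-monoˡ-< (m / n * n) (m%n<n m n) ⟩
  suc (m / n) * n     ∎
  where open ≤-Reasoning

m∸n≡suc⇒m≡n+suc : ∀ {m n d} → m ∸ n ≡ suc d → m ≡ n + suc d
m∸n≡suc⇒m≡n+suc {m} {n} m∸n≡1+d = trans (sym (m+[n∸m]≡n n≤m)) (cong (n +_) m∸n≡1+d)
  where
  n≤m : n ≤ m
  n≤m = <⇒≤ (m∸n≢0⇒n<m (λ m∸n≡0 → 0≢1+n (trans (sym m∸n≡0) m∸n≡1+d)))

4[x+t]∸p≡s+4t : ∀ p x s t → 4 * x ≡ p + s → 4 * (x + t) ∸ p ≡ s + 4 * t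
4[x+t]∸p≡s+4t p x s t 4x≡p+s = begin
  4 * (x + t) ∸ p       ≡⟨ cong (_∸ p) (*-distribˡ-+ 4 x t) ⟩
  4 * x + 4 * t ∸ p     ≡⟨ cong (λ w → w + 4 * t ∸ p) 4x≡p+s ⟩
  p + s + 4 * t ∸ p     ≡⟨ cong (_∸ p) (+-assoc p s (4 * t)) ⟩
  p + (s + 4 * t) ∸ p   ≡⟨ m+n∸m≡n p (s + 4 * t) ⟩
  s + 4 * t             ∎
  where open ≡-Reasoning

x*[s+4t]≡s*[x+t]+p*t : ∀ p x s t → 4 * x ≡ p + s → x * (s + 4 * t) ≡ s * (x + t) + p * t
x*[s+4t]≡s*[x+t]+p*t p x s t 4x≡p+s = begin
  x * (s + 4 * t)       ≡⟨ expand x s t ⟩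
  x * s + (4 * x) * t   ≡⟨ cong (λ w → x * s + w * t) 4x≡p+s ⟩
  x * s + (p + s) * t   ≡⟨ regroup x s t p ⟩
  s * (x + t) + p * t   ∎
  where
  open ≡-Reasoning
  expand : ∀ x s t → x * (s + 4 * t) ≡ x * s + (4 * x) * t
  expand = solve-∀
  regroup : ∀ x s t p → x * s + (p + s) * t ≡ s * (x + t) + p * t
  regroup = solve-∀

module _ (p x s t : ℕ) .{{_ : NonZero s}}
         (4x≡p+s : 4 * x ≡ p + s) (x+t≡1+⌊px/s⌋ : x + t ≡ suc (p * x / s)) where

  private
    y = x + t
    d = s + 4 * t
    q = p * x / s

    x*d≡s*y+p*t : x * d ≡ s * y + p * t
    x*d≡s*y+p*t = x*[s+4t]≡s*[x+t]+p*t p x s t 4x≡p+s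

  shifted-floor-upper : p * y < x * d
  shifted-floor-upper = begin-strict
    p * y             ≡⟨ *-distribˡ-+ p x t ⟩
    p * x + p * t     <⟨ +-monoˡ-< (p * t) (m<[1+m/n]*n (p * x) s) ⟩
    suc q * s + p * t ≡⟨ cong (λ w → w * s + p * t) (sym x+t≡1+⌊px/s⌋) ⟩
    y * s + p * t     ≡⟨ cong (_+ p * t) (*-comm y s) ⟩
    s * y + p * t     ≡⟨ sym x*d≡s*y+p*t ⟩
    x * d             ∎
    where open ≤-Reasoning

  shifted-floor-lower : x * d ≤ d + p * y
  shifted-floor-lower = begin
    x * d                   ≡⟨ x*d≡s*y+p*t ⟩
    s * y + p * t           ≡⟨ cong (λ w → s * w + p * t) x+t≡1+⌊px/s⌋ ⟩
    s * suc q + p * t       ≡⟨ cong (_+ p * t) (*-suc s q) ⟩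
    s + s * q + p * t       ≡⟨ +-assoc s (s * q) (p * t) ⟩
    s + (s * q + p * t)     ≤⟨ +-mono-≤ (m≤m+n s (4 * t)) (+-monoˡ-≤ (p * t) s*q≤p*x) ⟩
    d + (p * x + p * t)     ≡⟨ cong (d +_) (sym (*-distribˡ-+ p x t)) ⟩
    d + p * y               ∎
    where
    open ≤-Reasoning
    s*q≤p*x : s * q ≤ p * x
    s*q≤p*x = ≤-trans (≤-reflexive (*-comm s q)) (m/n*n≤m (p * x) s)

⌊p[x+t]/[s+4t]⌋≡pred-x : ∀ p k s t .{{_ : NonZero s}} .{{_ : NonZero (s + 4 * t)}} →
                          4 * suc k ≡ p + s → suc k + t ≡ suc (p * suc k / s) →
                          p * (suc k + t) / (s + 4 * t) ≡ k
⌊p[x+t]/[s+4t]⌋≡pred-x p k s t 4x≡p+s x+t≡1+⌊px/s⌋ = /-unique _ _ k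
  (+-cancelˡ-≤ (s + 4 * t) _ _ (shifted-floor-lower p (suc k) s t 4x≡p+s x+t≡1+⌊px/s⌋))
  (shifted-floor-upper p (suc k) s t 4x≡p+s x+t≡1+⌊px/s⌋)

proposition2p2 : (p x y z : ℕ) → Prime p →
                 0 < x → 0 < y → 0 < z → x ≤ y → y ≤ z →
                 EgyptianEq p x y z →
                 y ≡ floorDiv (p * x) (4 * x ∸ p) + 1 →
                 x ≡ floorDiv (p * y) (4 * y ∸ p) + 1
proposition2p2 p (suc k) y z _ _ _ _ x≤y _ _ hy with 4 * suc k ∸ p in 4x∸p≡s
... | suc d = begin
  x                                   ≡⟨ +-comm 1 k ⟩
  k + 1                               ≡⟨ cong (_+ 1) (sym ⌊p[x+t]/[s+4t]⌋≡k) ⟩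
  p * (x + t) / (s + 4 * t) + 1       ≡⟨ cong₂ (λ n m → floorDiv n m + 1) (cong (p *_) (sym y≡x+t)) (sym 4y∸p≡s+4t) ⟩
  floorDiv (p * y) (4 * y ∸ p) + 1    ∎
  where
  open ≡-Reasoning
  x = suc k
  s = suc d
  t = y ∸ x

  y≡x+t : y ≡ x + t
  y≡x+t = sym (m+[n∸m]≡n x≤y)

  4x≡p+s : 4 * x ≡ p + s
  4x≡p+s = m∸n≡suc⇒m≡n+suc 4x∸p≡s

  4y∸p≡s+4t : 4 * y ∸ p ≡ s + 4 * t
  4y∸p≡s+4t = trans (cong (λ w → 4 * w ∸ p) y≡x+t) (4[x+t]∸p≡s+4t p x s t 4x≡p+s)

  ⌊p[x+t]/[s+4t]⌋≡k : p * (x + t) / (s + 4 * t) ≡ k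
  ⌊p[x+t]/[s+4t]⌋≡k = ⌊p[x+t]/[s+4t]⌋≡pred-x p k s t 4x≡p+s
    (trans (sym y≡x+t) (trans hy (+-comm (p * x / s) 1)))
-- 4x ≤ p makes floorDiv divide by 0 and return 0, so y = 1 = x and also 4y ≤ p.
... | zero rewrite hy with x≤y
...   | s≤s z≤n rewrite 4x∸p≡s = refl
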